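{- Let $B$ be a set and let $\Phi$ be a formula of $\mathsf{LTL}$ over $B$ in which the negation connective $\neg$ does not occur. Then the set $[\![\Phi]\!] \subseteq [\![\mathrm{Stream}\,B]\!]$ is upward-closed: if $\sigma \in [\![\Phi]\!]$ and $\sigma \le \tau$ in $[\![\mathrm{Stream}\,B]\!]$, then $\tau \in [\![\Phi]\!]$.
   Context: $[\![B]\!]$ is the flat cpo $B \cup \{\bot\}$ (with $\bot$ below every element and distinct elements of $B$ incomparable). $[\![\mathrm{Stream}\,B]\!]$ is the set of all functions $\sigma:\mathbb{N}\to[\![B]\!]$ ordered pointwise. For $i\in\mathbb{N}$, $\sigma\restriction i$ is the stream $n\mapsto\sigma(n+i)$. Formulas of $\mathsf{LTL}$ over $B$ are generated by $\Phi ::= a \ (a\in B) \mid \mathrm{True} \mid \mathrm{False} \mid \Phi\vee\Phi \mid \Phi\wedge\Phi \mid \neg\Phi \mid \bigcirc\Phi \mid \Phi\,\mathsf{U}\,\Phi \mid \Phi\,\mathsf{W}\,\Phi$, interpreted as subsets of $[\![\mathrm{Stream}\,B]\!]$: $[\![a]\!]=\{\sigma\mid\sigma(0)=a\}$, $[\![\mathrm{True}]\!]$ is everything, $[\![\mathrm{False}]\!]=\emptyset$, $\vee,\wedge,\neg$ are union, intersection, complement, $[\![\bigcirc\Phi]\!]=\{\sigma\mid \sigma\restriction 1\in[\![\Phi]\!]\}$, $\sigma\in[\![\Phi\,\mathsf{U}\,\Psi]\!]$ iff there is $i\ge 0$ with $\sigma\restriction j\in[\![\Phi]\!]$ for all $j<i$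 and $\sigma\restriction i\in[\![\Psi]\!]$, and $[\![\Phi\,\mathsf{W}\,\Psi]\!]=[\![\Phi\,\mathsf{U}\,\Psi]\!]\cup\{\sigma\mid \forall i,\ \sigma\restriction i\in[\![\Phi]\!]\}$. -}

module Defs where

open import Data.Nat using (ℕ; zero; suc; _+_; _<_)
open import Data.Maybe using (Maybe; just; nothing)
open import Data.Product using (Σ; _×_; ∃-syntax)
open import Data.Sum using (_⊎_)
open import Data.Unit using (⊤)
open import Data.Empty using (⊥)
open import Relation.Nullary using (¬_)
open import Relation.Binary.PropositionalEquality using (_≡_)

-- The flat cpo [[B]] = B ∪ {⊥}, with nothing playing the role of ⊥.
Flat : Set → Set
Flat B = Maybe B

_⊑_ : {B : Set} → Flat B → Flat B → Set
x ⊑ y = (x ≡ nothing) ⊎ (x ≡ y)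

Stream : Set → Set
Stream B = ℕ → Flat B

_≤ₛ_ : {B : Set} → Stream B → Stream B → Set
σ ≤ₛ τ = ∀ n → σ n ⊑ τ n

_↾_ : {B : Set} → Stream B → ℕ → Stream B
(σ ↾ i) n = σ (n + i)

data LTL (B : Set) : Set where
  atom  : B → LTL B
  True  : LTL B
  False : LTL B
  _∨ₗ_  : LTL B → LTL B → LTL B
  _∧ₗ_  : LTL B → LTL B → LTL B
  ¬ₗ_   : LTL B → LTL B
  ○_    : LTL B → LTL B
  _U_   : LTL B → LTL B → LTL B
  _W_   : LTL B → LTL B → LTL B

⟦_⟧ : {B : Set} → LTL B → Stream B → Set
⟦ atom a ⟧ σ = σ 0 ≡ just a
⟦ True ⟧ σ = ⊤
⟦ False ⟧ σ = ⊥
⟦ Φ ∨ₗ Ψ ⟧ σ = ⟦ Φ ⟧ σ ⊎ ⟦ Ψ ⟧ σ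
⟦ Φ ∧ₗ Ψ ⟧ σ = ⟦ Φ ⟧ σ × ⟦ Ψ ⟧ σ
⟦ ¬ₗ Φ ⟧ σ = ¬ ⟦ Φ ⟧ σ
⟦ ○ Φ ⟧ σ = ⟦ Φ ⟧ (σ ↾ 1)
⟦ Φ U Ψ ⟧ σ = ∃[ i ] ((∀ j → j < i → ⟦ Φ ⟧ (σ ↾ j)) × ⟦ Ψ ⟧ (σ ↾ i))
⟦ Φ W Ψ ⟧ σ = (∃[ i ] ((∀ j → j < i → ⟦ Φ ⟧ (σ ↾ j)) × ⟦ Ψ ⟧ (σ ↾ i)))
              ⊎ (∀ i → ⟦ Φ ⟧ (σ ↾ i))

data NegFree {B : Set} : LTL B → Set where
  atom  : (a : B) → NegFree (atom a)
  True  : NegFree True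
  False : NegFree False
  _∨ₗ_  : {Φ Ψ : LTL B} → NegFree Φ → NegFree Ψ → NegFree (Φ ∨ₗ Ψ)
  _∧ₗ_  : {Φ Ψ : LTL B} → NegFree Φ → NegFree Ψ → NegFree (Φ ∧ₗ Ψ)
  ○_    : {Φ : LTL B} → NegFree Φ → NegFree (○ Φ)
  _U_   : {Φ Ψ : LTL B} → NegFree Φ → NegFree Ψ → NegFree (Φ U Ψ)
  _W_   : {Φ Ψ : LTL B} → NegFree Φ → NegFree Ψ → NegFree (Φ W Ψ)

UpwardClosed : {B : Set} → (Stream B → Set) → Set
UpwardClosed {B} P = (σ τ : Stream B) → P σ → σ ≤ₛ τ → P τ

module Submission where

open import Defs
open import Data.Nat using (_+_)
open import Data.Maybe using (just)
open import Data.Product using (_,_)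
open import Data.Sum using (inj₁; inj₂)
open import Data.Unit using (tt)
open import Relation.Binary.PropositionalEquality using (_≡_; refl; sym; trans)

-- Every connective except ¬ is monotone in its arguments, and atoms only
-- test for a defined value, which survives refinement; induction on the
-- negation-free formula then gives upward closure.

just-⊑ : {B : Set} {x y : Flat B} {a : B} → x ≡ just a → x ⊑ y → y ≡ just a
just-⊑ refl (inj₁ ())
just-⊑ x≡a  (inj₂ x≡y) = trans (sym x≡y) x≡a

↾-mono : {B : Set} {σ τ : Stream B} → σ ≤ₛ τ → ∀ i → (σ ↾ i) ≤ₛ (τ ↾ i)
↾-mono σ≤τ i n = σ≤τ (n + i)

module _ {B : Set} where

  upward-atom : (a : B) → UpwardClosed ⟦ atom a ⟧
  upward-atom a σ τ σ₀≡a σ≤τ = just-⊑ σ₀≡a (σ≤τ 0)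

  upward-∨ : (Φ Ψ : LTL B) → UpwardClosed ⟦ Φ ⟧ → UpwardClosed ⟦ Ψ ⟧ →
             UpwardClosed ⟦ Φ ∨ₗ Ψ ⟧
  upward-∨ Φ Ψ upΦ upΨ σ τ (inj₁ p) σ≤τ = inj₁ (upΦ σ τ p σ≤τ)
  upward-∨ Φ Ψ upΦ upΨ σ τ (inj₂ q) σ≤τ = inj₂ (upΨ σ τ q σ≤τ)

  upward-∧ : (Φ Ψ : LTL B) → UpwardClosed ⟦ Φ ⟧ → UpwardClosed ⟦ Ψ ⟧ →
             UpwardClosed ⟦ Φ ∧ₗ Ψ ⟧
  upward-∧ Φ Ψ upΦ upΨ σ τ (p , q) σ≤τ = upΦ σ τ p σ≤τ , upΨ σ τ q σ≤τ

  upward-○ : (Φ : LTL B) → UpwardClosed ⟦ Φ ⟧ → UpwardClosed ⟦ ○ Φ ⟧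
  upward-○ Φ upΦ σ τ p σ≤τ = upΦ (σ ↾ 1) (τ ↾ 1) p (↾-mono σ≤τ 1)

  upward-U : (Φ Ψ : LTL B) → UpwardClosed ⟦ Φ ⟧ → UpwardClosed ⟦ Ψ ⟧ →
             UpwardClosed ⟦ Φ U Ψ ⟧
  upward-U Φ Ψ upΦ upΨ σ τ (i , before , at) σ≤τ =
    i , (λ j j<i → upΦ (σ ↾ j) (τ ↾ j) (before j j<i) (↾-mono σ≤τ j))
      , upΨ (σ ↾ i) (τ ↾ i) at (↾-mono σ≤τ i)

  upward-W : (Φ Ψ : LTL B) → UpwardClosed ⟦ Φ ⟧ → UpwardClosed ⟦ Ψ ⟧ →
             UpwardClosed ⟦ Φ W Ψ ⟧
  upward-W Φ Ψ upΦ upΨ σ τ (inj₁ until) σ≤τ =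
    inj₁ (upward-U Φ Ψ upΦ upΨ σ τ until σ≤τ)
  upward-W Φ Ψ upΦ upΨ σ τ (inj₂ always) σ≤τ =
    inj₂ (λ i → upΦ (σ ↾ i) (τ ↾ i) (always i) (↾-mono σ≤τ i))

  negFree-upward : {Φ : LTL B} → NegFree Φ → UpwardClosed ⟦ Φ ⟧
  negFree-upward (atom a)           = upward-atom a
  negFree-upward True               = λ _ _ _ _ → tt
  negFree-upward False              = λ _ _ ()
  negFree-upward (_∨ₗ_ {Φ} {Ψ} φ ψ) = upward-∨ Φ Ψ (negFree-upward φ) (negFree-upward ψ)
  negFree-upward (_∧ₗ_ {Φ} {Ψ} φ ψ) = upward-∧ Φ Ψ (negFree-upward φ) (negFree-upward ψ)
  negFree-upward (○_ {Φ} φ)         = upward-○ Φ (negFree-upward φ)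
  negFree-upward (_U_ {Φ} {Ψ} φ ψ)  = upward-U Φ Ψ (negFree-upward φ) (negFree-upward ψ)
  negFree-upward (_W_ {Φ} {Ψ} φ ψ)  = upward-W Φ Ψ (negFree-upward φ) (negFree-upward ψ)

mainTheorem1 : (B : Set) → (Φ : LTL B) → NegFree Φ → UpwardClosed ⟦ Φ ⟧
mainTheorem1 B Φ = negFree-upward
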